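{- Let $\mathcal{L}[\mathcal{Q}]$ be a $k$-quantifier logic and $(\mathfrak{A},\alpha)$, $(\mathfrak{B},\beta)$ a pair of $k$-pointed $\sigma$-structures such that $\mathfrak{A}$ and $\mathfrak{B}$ are $\mathcal{L}[\mathcal{Q}]$-saturated. If $(\mathfrak{A},\alpha)\equiv_{\mathcal{L}[\mathcal{Q}]}(\mathfrak{B},\beta)$, then $(\mathfrak{A},\alpha)\sim_{\mathcal{L}[\mathcal{Q}]}(\mathfrak{B},\beta)$.
   Context: All signatures are purely relational. Fix $k\ge1$ and variables $x_1,\dots,x_k$; a $k$-pointed $\sigma$-structure is a pair $(\mathfrak{A},\alpha)$ with $\alpha\in A^k$ (the assignment $x_i\mapsto\alpha(x_i)$). A $k$-quantifier $Q$ consists of a signature $\sigma_Q$ and, for every structure $\mathfrak{A}$ over a signature containing $\sigma_Q$ and every $\alpha\in A^k$, a witness set $Q(\mathfrak{A},\alpha)\subseteq\mathcal{P}(A^k)$, such that for every isomorphism $\iota:\mathfrak{A}\restriction\sigma_Q\cong\mathfrak{B}\restriction\sigma_Q$ and $\alpha\in A^k$: $Q(\mathfrak{B}\restriction\sigma_Q,\iota\circ\alpha)=Q(\mathfrak{B},\iota\circ\alpha)=\{\{\iota\circ\gamma:\gamma\in s\}:s\in Q(\mathfrak{A}\restriction\sigma_Q,\alpha)\}$. For a class $\mathcal{Q}$ of $k$-quantifiers, $\mathcal{Q}_\sigma=\{Q\in\mathcal{Q}:\sigma_Q\subseteq\sigma\}$. The $k$-quantifier logic $\mathcal{L}[\mathcal{Q}]$: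 formulas over $\sigma$ are built from $\top$ and atoms $R(y_1,\dots,y_l)$ ($R\in\sigma$, $y_j\in\{x_1,\dots,x_k\}$) by $\neg$, $\wedge$, and $Q\varphi$ for $Q\in\mathcal{Q}_\sigma$; semantics is the usual one for $\top$, atoms, $\neg,\wedge$, and $\mathfrak{A},\alpha\models Q\varphi$ iff some $s\in Q(\mathfrak{A},\alpha)$ has $\mathfrak{A},\gamma\models\varphi$ for all $\gamma\in s$. For $s\subseteq A^k$ write $\mathfrak{A},s\models\varphi$ (resp. $\mathfrak{A},s\models\Psi$ for a set $\Psi$) if every $\gamma\in s$ satisfies $\varphi$ (resp. all of $\Psi$). $(\mathfrak{A},\alpha)\equiv_{\mathcal{L}[\mathcal{Q}]}(\mathfrak{B},\beta)$ means they satisfy the same formulas of $\mathcal{L}[\mathcal{Q}](\sigma)$. Saturation. Let $\mathfrak{A}$ be a $\sigma$-structure, $Q\in\mathcal{Q}_\sigma$, $\alpha\in A^k$. A set $\Psi\subseteq\mathcal{L}[\mathcal{Q}](\sigma)$ is a $Q$-type of $(\mathfrak{A},\alpha)$ if $\mathfrak{A},\alpha\models Q\bigwedge\Psi_0$ for every finite $\Psi_0\subseteq\Psi$; it is realised by $s\in Q(\mathfrak{A},\alpha)$ if $\mathfrak{A},s\models\Psi$. For $s\in Q(\mathfrak{A},\alpha)$, $\Psi$ is an $s$-type if for every finite $\Psi_0\subseteq\Psi$ there is $\gamma\in s$ with $\mathfrak{A},\gamma\models\Psi_0$; it is realised by $\gamma\in s$ if $\mathfrak{A},\gamma\models\Psi$.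 $\mathfrak{A}$ is $\mathcal{L}[\mathcal{Q}]$-saturated if for all $Q\in\mathcal{Q}_\sigma$ and $\alpha\in A^k$, every $Q$-type of $(\mathfrak{A},\alpha)$ and every $s$-type of every $s\in Q(\mathfrak{A},\alpha)$ is realised. Bisimulation game: players I and II, positions $(\mathfrak{A},\alpha;\mathfrak{B},\beta)$. II loses in any position where the two sides are distinguished by a quantifier-free formula. A round: I picks a side, say $(\mathfrak{A},\alpha)$ (symmetrically for the other), $Q\in\mathcal{Q}_\sigma$ and $s\in Q(\mathfrak{A},\alpha)$; II answers $t\in Q(\mathfrak{B},\beta)$; I picks $\delta\in t$; II answers $\gamma\in s$; new position $(\mathfrak{A},\gamma;\mathfrak{B},\delta)$. A player unable to move loses; II wins if I loses or the play is infinite without II losing. $(\mathfrak{A},\alpha)\sim_{\mathcal{L}[\mathcal{Q}]}(\mathfrak{B},\beta)$ if II has a winning strategy from that position. -}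

module Defs where

open import Level using (Lift)
open import Data.Nat using (ℕ)
open import Data.Fin using (Fin)
open import Data.Product using (Σ; _×_; _,_)
open import Data.Unit using (⊤)
open import Data.List using (List; []; _∷_)
open import Data.List.Relation.Unary.All using (All)
open import Relation.Nullary using (¬_)
open import Relation.Binary.PropositionalEquality using (_≡_)
open import Function.Base using (_∘_)
open import Function.Bundles using (_↔_; Inverse; _⇔_)

record Vocabulary : Set₁ where
  field
    Sym : Set
    ar  : Sym → ℕ
open Vocabulary public

Signature : Vocabulary → Set₁
Signature V = Sym V → Set

_⊆ˢ_ : {X : Set} → (X → Set) → (X → Set) → Set
σ ⊆ˢ τ = ∀ R → σ R → τ R

-- A structure interprets every symbol of the vocabulary; a σ-structure is
-- a structure of which only the symbols in σ are ever looked at (all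
-- notions below only refer to symbols in σ, resp. in σ_Q).
record Structure (V : Vocabulary) : Set₁ where
  field
    Carrier : Set
    rel     : (R : Sym V) → (Fin (ar V R) → Carrier) → Set
open Structure public

Assignment : {V : Vocabulary} → Structure V → ℕ → Set
Assignment 𝔄 k = Fin k → Carrier 𝔄

AssignSet : {V : Vocabulary} → Structure V → ℕ → Set₁
AssignSet 𝔄 k = Assignment 𝔄 k → Set

_≐_ : {X : Set} → (X → Set) → (X → Set) → Set
s ≐ t = ∀ γ → (s γ ⇔ t γ)

IsIsoOn : {V : Vocabulary} → Signature V → (𝔄 𝔅 : Structure V) → (Carrier 𝔄 ↔ Carrier 𝔅) → Set
IsIsoOn {V} τ 𝔄 𝔅 ι =
  ∀ R → τ R → (a : Fin (ar V R) → Carrier 𝔄) → rel 𝔄 R a ⇔ rel 𝔅 R (Inverse.to ι ∘ a)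

image : {V : Vocabulary} {𝔄 𝔅 : Structure V} {k : ℕ} → (Carrier 𝔄 ↔ Carrier 𝔅) →
        AssignSet 𝔄 k → AssignSet 𝔅 k
image {𝔄 = 𝔄} {k = k} ι s δ = Σ (Assignment 𝔄 k) λ γ → s γ × (∀ i → Inverse.to ι (γ i) ≡ δ i)

-- W 𝔄 α is the witness set Q(𝔄,α) ⊆ P(A^k).  The
-- invariance condition (for all σ_Q-isomorphisms ι between arbitrary
-- structures, Q(𝔅, ι∘α) = {ι∘s : s ∈ Q(𝔄,α)}) in particular (ι = id)
-- says Q(𝔅,β) = Q(𝔅↾σ_Q,β).

record Quantifier (V : Vocabulary) (k : ℕ) : Set₁ where
  field
    sigQ      : Signature V
    W         : (𝔄 : Structure V) → Assignment 𝔄 k → AssignSet 𝔄 k → Set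
    invariant : (𝔄 𝔅 : Structure V) (ι : Carrier 𝔄 ↔ Carrier 𝔅) → IsIsoOn sigQ 𝔄 𝔅 ι →
                (α : Assignment 𝔄 k) (t : AssignSet 𝔅 k) →
                W 𝔅 (Inverse.to ι ∘ α) t ⇔
                Σ (AssignSet 𝔄 k) (λ s → W 𝔄 α s × (t ≐ image {𝔄 = 𝔄} {𝔅 = 𝔅} ι s))
open Quantifier public

data Form {V : Vocabulary} {k : ℕ} (𝒬 : Quantifier V k → Set) (σ : Signature V) : Set₁ where
  ⊤f    : Form 𝒬 σ
  atom  : (R : Sym V) → σ R → (Fin (ar V R) → Fin k) → Form 𝒬 σ
  ¬f_   : Form 𝒬 σ → Form 𝒬 σ
  _∧f_  : Form 𝒬 σ → Form 𝒬 σ → Form 𝒬 σ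
  quant : (Q : Quantifier V k) → 𝒬 Q → sigQ Q ⊆ˢ σ → Form 𝒬 σ → Form 𝒬 σ

data IsQF {V : Vocabulary} {k : ℕ} {𝒬 : Quantifier V k → Set} {σ : Signature V} :
          Form 𝒬 σ → Set₁ where
  ⊤qf    : IsQF ⊤f
  atomqf : ∀ R p y → IsQF (atom R p y)
  ¬qf    : ∀ {φ} → IsQF φ → IsQF (¬f φ)
  ∧qf    : ∀ {φ ψ} → IsQF φ → IsQF ψ → IsQF (φ ∧f ψ)

Sat : {V : Vocabulary} {k : ℕ} {𝒬 : Quantifier V k → Set} {σ : Signature V} →
      (𝔄 : Structure V) → Assignment 𝔄 k → Form 𝒬 σ → Set₁
Sat 𝔄 α ⊤f             = Lift _ ⊤
Sat 𝔄 α (atom R _ y)   = Lift _ (rel 𝔄 R (α ∘ y))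
Sat 𝔄 α (¬f φ)         = ¬ Sat 𝔄 α φ
Sat 𝔄 α (φ ∧f ψ)       = Sat 𝔄 α φ × Sat 𝔄 α ψ
Sat {k = k} 𝔄 α (quant Q _ _ φ) =
  Σ (AssignSet 𝔄 k) λ s → W Q 𝔄 α s × (∀ γ → s γ → Sat 𝔄 γ φ)

⋀ : {V : Vocabulary} {k : ℕ} {𝒬 : Quantifier V k → Set} {σ : Signature V} →
    List (Form 𝒬 σ) → Form 𝒬 σ
⋀ []       = ⊤f
⋀ (φ ∷ Φ)  = φ ∧f ⋀ Φ

module _ {V : Vocabulary} {k : ℕ} (𝒬 : Quantifier V k → Set) (σ : Signature V)
         (𝔄 : Structure V) where

  IsQType : (Q : Quantifier V k) → 𝒬 Q → sigQ Q ⊆ˢ σ → Assignment 𝔄 k →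
            (Form 𝒬 σ → Set₁) → Set₁
  IsQType Q q sub α Ψ = (Ψ₀ : List (Form 𝒬 σ)) → All Ψ Ψ₀ → Sat 𝔄 α (quant Q q sub (⋀ Ψ₀))

  IsSType : AssignSet 𝔄 k → (Form 𝒬 σ → Set₁) → Set₁
  IsSType s Ψ = (Ψ₀ : List (Form 𝒬 σ)) → All Ψ Ψ₀ →
                Σ (Assignment 𝔄 k) λ γ → s γ × All (Sat 𝔄 γ) Ψ₀

  Saturated : Set₂
  Saturated =
    ((Q : Quantifier V k) (q : 𝒬 Q) (sub : sigQ Q ⊆ˢ σ) (α : Assignment 𝔄 k)
     (Ψ : Form 𝒬 σ → Set₁) → IsQType Q q sub α Ψ →
     Σ (AssignSet 𝔄 k) λ s → W Q 𝔄 α s × (∀ γ → s γ → ∀ ψ → Ψ ψ → Sat 𝔄 γ ψ))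
    ×
    ((Q : Quantifier V k) (q : 𝒬 Q) (sub : sigQ Q ⊆ˢ σ) (α : Assignment 𝔄 k)
     (s : AssignSet 𝔄 k) → W Q 𝔄 α s → (Ψ : Form 𝒬 σ → Set₁) → IsSType s Ψ →
     Σ (Assignment 𝔄 k) λ γ → s γ × (∀ ψ → Ψ ψ → Sat 𝔄 γ ψ))

module _ {V : Vocabulary} {k : ℕ} (𝒬 : Quantifier V k → Set) (σ : Signature V)
         (𝔄 𝔅 : Structure V) where

  Equiv : Assignment 𝔄 k → Assignment 𝔅 k → Set₁
  Equiv α β = (φ : Form 𝒬 σ) → Sat 𝔄 α φ ⇔ Sat 𝔅 β φ

  -- Since II's winning condition is a safety
  -- condition (II wins iff she never reaches a losing position), II has a
  -- winning strategy from a position iff the position lies in some set Z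
  -- of positions that is "safe for II": every position in Z is not lost
  -- (no quantifier-free formula distinguishes the sides), and for every
  -- move of I from a position in Z, II has a reply that keeps the play in Z.
  -- (Such a Z is exactly an invariant describing a winning strategy; the
  -- set of positions from which II has a winning strategy is the largest
  -- such Z.)  Positions are (𝔄,γ;𝔅,δ).
  record IsWinRegion (Z : Assignment 𝔄 k → Assignment 𝔅 k → Set₁) : Set₂ where
    field
      qf    : ∀ α β → Z α β → (φ : Form 𝒬 σ) → IsQF φ → Sat 𝔄 α φ ⇔ Sat 𝔅 β φ
      -- I plays on the 𝔄-side: Q ∈ 𝒬_σ, s ∈ Q(𝔄,α); II answers t ∈ Q(𝔅,β);
      -- for every δ ∈ t chosen by I, II answers some γ ∈ s staying in Z
      forth : ∀ α β → Z α β →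
              (Q : Quantifier V k) → 𝒬 Q → sigQ Q ⊆ˢ σ →
              (s : AssignSet 𝔄 k) → W Q 𝔄 α s →
              Σ (AssignSet 𝔅 k) λ t → W Q 𝔅 β t ×
                ((δ : Assignment 𝔅 k) → t δ → Σ (Assignment 𝔄 k) λ γ → s γ × Z γ δ)
      back  : ∀ α β → Z α β →
              (Q : Quantifier V k) → 𝒬 Q → sigQ Q ⊆ˢ σ →
              (t : AssignSet 𝔅 k) → W Q 𝔅 β t →
              Σ (AssignSet 𝔄 k) λ s → W Q 𝔄 α s ×
                ((γ : Assignment 𝔄 k) → s γ → Σ (Assignment 𝔅 k) λ δ → t δ × Z γ δ)

  Bisim : Assignment 𝔄 k → Assignment 𝔅 k → Set₂
  Bisim α β = Σ (Assignment 𝔄 k → Assignment 𝔅 k → Set₁) λ Z → IsWinRegion Z × Z α β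

-- Take as bisimulation the relation of L[𝒬]-equivalence itself.  If I plays
-- s ∈ Q(𝔄,α), the theory of s (the formulas true throughout s) is a Q-type of
-- (𝔅,β) by equivalence, so saturation of 𝔅 yields t ∈ Q(𝔅,β) realising it.
-- For δ ∈ t, the theory of δ is an s-type (otherwise some ¬⋀Θ₀ with Θ₀ true
-- at δ would hold throughout s), so saturation of 𝔄 yields γ ∈ s realising it;
-- as theories are closed under negation, γ and δ are then equivalent.
module Submission where

open import Defs
open import Level using (zero; suc)
open import Data.Nat using (ℕ; _≤_)
open import Data.Product using (Σ; _×_; _,_; map₂)
open import Data.List using (List; []; _∷_)
open import Data.List.Relation.Unary.All as All using (All; []; _∷_)
open import Relation.Nullary using (¬_)
open import Function.Bundles using (_⇔_; mk⇔; Equivalence)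
open import Axiom.ExcludedMiddle using (ExcludedMiddle)
open import Axiom.DoubleNegationElimination using (DoubleNegationElimination; em⇒dne)

module _ {V : Vocabulary} {k : ℕ} {𝒬 : Quantifier V k → Set} {σ : Signature V} where

  Sat-⋀⁺ : {𝔄 : Structure V} {γ : Assignment 𝔄 k} (Ψ₀ : List (Form 𝒬 σ)) →
           All (Sat 𝔄 γ) Ψ₀ → Sat 𝔄 γ (⋀ Ψ₀)
  Sat-⋀⁺ []       []       = _
  Sat-⋀⁺ (_ ∷ Ψ₀) (p ∷ ps) = p , Sat-⋀⁺ Ψ₀ ps

  Sat-⋀⁻ : {𝔄 : Structure V} {γ : Assignment 𝔄 k} (Ψ₀ : List (Form 𝒬 σ)) →
           Sat 𝔄 γ (⋀ Ψ₀) → All (Sat 𝔄 γ) Ψ₀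
  Sat-⋀⁻ []       _        = []
  Sat-⋀⁻ (_ ∷ Ψ₀) (p , ps) = p ∷ Sat-⋀⁻ Ψ₀ ps

  Equiv-sym : {𝔄 𝔅 : Structure V} {α : Assignment 𝔄 k} {β : Assignment 𝔅 k} →
              Equiv 𝒬 σ 𝔄 𝔅 α β → Equiv 𝒬 σ 𝔅 𝔄 β α
  Equiv-sym α≈β φ = mk⇔ (Equivalence.from (α≈β φ)) (Equivalence.to (α≈β φ))

  Th : (𝔄 : Structure V) → Assignment 𝔄 k → Form 𝒬 σ → Set₁
  Th 𝔄 γ φ = Sat 𝔄 γ φ

  Thˢ : (𝔄 : Structure V) → AssignSet 𝔄 k → Form 𝒬 σ → Set₁
  Thˢ 𝔄 s φ = ∀ γ → s γ → Sat 𝔄 γ φ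

  Thˢ-isQType : {𝔄 𝔅 : Structure V} {α : Assignment 𝔄 k} {β : Assignment 𝔅 k} →
                Equiv 𝒬 σ 𝔄 𝔅 α β →
                (Q : Quantifier V k) (q : 𝒬 Q) (sub : sigQ Q ⊆ˢ σ) →
                {s : AssignSet 𝔄 k} → W Q 𝔄 α s →
                IsQType 𝒬 σ 𝔅 Q q sub β (Thˢ 𝔄 s)
  Thˢ-isQType α≈β Q q sub {s} s∈Q Ψ₀ s⊨Ψ₀ =
    Equivalence.to (α≈β (quant Q q sub (⋀ Ψ₀)))
      (s , s∈Q , λ γ γ∈s → Sat-⋀⁺ Ψ₀ (All.map (λ s⊨ψ → s⊨ψ γ γ∈s) s⊨Ψ₀))

  module _ (dne : DoubleNegationElimination (suc zero)) where

    Th-isSType : {𝔄 𝔅 : Structure V} {s : AssignSet 𝔄 k} {δ : Assignment 𝔅 k} →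
                 (∀ φ → Thˢ 𝔄 s φ → Sat 𝔅 δ φ) → IsSType 𝒬 σ 𝔄 s (Th 𝔅 δ)
    Th-isSType {𝔄} {s = s} {δ} s⊆δ Θ₀ δ⊨Θ₀ = dne ¬¬witness
      where
      ¬¬witness : ¬ ¬ Σ (Assignment 𝔄 k) λ γ → s γ × All (Sat 𝔄 γ) Θ₀
      ¬¬witness none =
        s⊆δ (¬f ⋀ Θ₀) (λ γ γ∈s γ⊨Θ₀ → none (γ , γ∈s , Sat-⋀⁻ Θ₀ γ⊨Θ₀)) (Sat-⋀⁺ Θ₀ δ⊨Θ₀)

    Th⊆⇒Equiv : {𝔄 𝔅 : Structure V} {γ : Assignment 𝔄 k} {δ : Assignment 𝔅 k} →
                (∀ φ → Sat 𝔅 δ φ → Sat 𝔄 γ φ) → Equiv 𝒬 σ 𝔄 𝔅 γ δ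
    Th⊆⇒Equiv δ⊆γ φ = mk⇔ (λ γ⊨φ → dne (λ δ⊭φ → δ⊆γ (¬f φ) δ⊭φ γ⊨φ)) (δ⊆γ φ)

    Equiv-forth : {𝔄 𝔅 : Structure V} → Saturated 𝒬 σ 𝔄 → Saturated 𝒬 σ 𝔅 →
                  {α : Assignment 𝔄 k} {β : Assignment 𝔅 k} → Equiv 𝒬 σ 𝔄 𝔅 α β →
                  (Q : Quantifier V k) → 𝒬 Q → sigQ Q ⊆ˢ σ →
                  (s : AssignSet 𝔄 k) → W Q 𝔄 α s →
                  Σ (AssignSet 𝔅 k) λ t → W Q 𝔅 β t ×
                    ((δ : Assignment 𝔅 k) → t δ →
                       Σ (Assignment 𝔄 k) λ γ → s γ × Equiv 𝒬 σ 𝔄 𝔅 γ δ)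
    Equiv-forth {𝔄} {𝔅} (_ , sat𝔄ˢ) (sat𝔅Q , _) {α} {β} α≈β Q q sub s s∈Q
      with sat𝔅Q Q q sub β (Thˢ 𝔄 s) (Thˢ-isQType α≈β Q q sub s∈Q)
    ... | t , t∈Q , t⊨Ths = t , t∈Q , answer
      where
      answer : (δ : Assignment 𝔅 k) → t δ → Σ (Assignment 𝔄 k) λ γ → s γ × Equiv 𝒬 σ 𝔄 𝔅 γ δ
      answer δ δ∈t with sat𝔄ˢ Q q sub α s s∈Q (Th 𝔅 δ) (Th-isSType (t⊨Ths δ δ∈t))
      ... | γ , γ∈s , γ⊨Thδ = γ , γ∈s , Th⊆⇒Equiv γ⊨Thδ

    Equiv-back : {𝔄 𝔅 : Structure V} → Saturated 𝒬 σ 𝔄 → Saturated 𝒬 σ 𝔅 →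
                 {α : Assignment 𝔄 k} {β : Assignment 𝔅 k} → Equiv 𝒬 σ 𝔄 𝔅 α β →
                 (Q : Quantifier V k) → 𝒬 Q → sigQ Q ⊆ˢ σ →
                 (t : AssignSet 𝔅 k) → W Q 𝔅 β t →
                 Σ (AssignSet 𝔄 k) λ s → W Q 𝔄 α s ×
                   ((γ : Assignment 𝔄 k) → s γ →
                      Σ (Assignment 𝔅 k) λ δ → t δ × Equiv 𝒬 σ 𝔄 𝔅 γ δ)
    Equiv-back sat𝔄 sat𝔅 α≈β Q q sub t t∈Q =
      map₂ (map₂ λ answer γ γ∈s → map₂ (map₂ Equiv-sym) (answer γ γ∈s))
        (Equiv-forth sat𝔅 sat𝔄 (Equiv-sym α≈β) Q q sub t t∈Q)

    Equiv-isWinRegion : {𝔄 𝔅 : Structure V} → Saturated 𝒬 σ 𝔄 → Saturated 𝒬 σ 𝔅 →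
                        IsWinRegion 𝒬 σ 𝔄 𝔅 (Equiv 𝒬 σ 𝔄 𝔅)
    Equiv-isWinRegion sat𝔄 sat𝔅 = record
      { qf    = λ _ _ α≈β φ _ → α≈β φ
      ; forth = λ _ _ → Equiv-forth sat𝔄 sat𝔅
      ; back  = λ _ _ → Equiv-back sat𝔄 sat𝔅
      }

theorem5p2 : ExcludedMiddle (suc zero) →
    (V : Vocabulary) (k : ℕ) → 1 ≤ k →
    (𝒬 : Quantifier V k → Set) (σ : Signature V)
    (𝔄 𝔅 : Structure V) (α : Assignment 𝔄 k) (β : Assignment 𝔅 k) →
    Saturated 𝒬 σ 𝔄 → Saturated 𝒬 σ 𝔅 →
    Equiv 𝒬 σ 𝔄 𝔅 α β → Bisim 𝒬 σ 𝔄 𝔅 α β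
theorem5p2 em V k _ 𝒬 σ 𝔄 𝔅 α β sat𝔄 sat𝔅 α≈β =
  Equiv 𝒬 σ 𝔄 𝔅 , Equiv-isWinRegion (em⇒dne em) sat𝔄 sat𝔅 , α≈β
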